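{- For any integer $k\geq 1$ and any $e\in\{0,1,\ldots,k-1\}$, the mapping $f$ restricted to $D_{2k}^e$ is a bijection between $D_{2k}^e$ and $D_{2k}^{e+1}$. Moreover, for every $x\in D_{2k}^e$, the Dyck paths $x$ and $f(x)$ (viewed as sequences of $2k$ steps) differ in exactly two positions.
   Context: A lattice path with $n$ steps is a sequence $x=(x_1,\ldots,x_n)$ of steps, each either an up-step $(1,1)$ or a down-step $(1,-1)$, drawn in $\mathbb{Z}^2$ starting at the origin; step $x_i$ goes from $(i-1,h_{i-1})$ to $(i,h_i)$, where $h_i$ is the height after $i$ steps. A step lies below the line $y=c$ if both of its endpoints have $y$-coordinate at most $c$. A step touches the line $y=c$ if it starts or ends on that line. For $c\in\mathbb{Z}$, $u_c(x)$ and $d_c(x)$ denote the number of up-steps, respectively down-steps, of $x$ that start on the line $y=c$. Let $L_{2k,k}$ (resp. $L_{2k,k+1}$) be the set of lattice paths with $2k$ steps of which exactly $k$ (resp. $k+1$) are up-steps. For $e\in\{0,\ldots,k\}$, $D_{2k}^e$ is the set of paths in $L_{2k,k}$ having exactly $e$ down-steps below the line $y=0$ (Dyck paths with $2k$ steps and $e$ flaws). For $x\in L_{2k,k}\setminus D_{2k}^k$, let $g(x)$ be the path obtained from $x$ by replacing by an up-step the $(d_0(x)+1)$-th (counted from the left) down-step of $x$ touching the line $y=0$. For $x'\in L_{2k,k+1}$, let $h(x')$ be the path obtained from $x'$ by replacing by a down-step the $u_1(x')$-th (counted from the left) up-step of $x'$ touching the line $y=1$. Define $f(x):=h(g(x))$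 for $x\in L_{2k,k}\setminus D_{2k}^k$. -}

module Defs where

open import Data.Nat using (ℕ; zero; suc; _+_; _*_)
open import Data.Integer as ℤ using (ℤ; +_; _≤?_)
open import Data.Integer using () renaming (_+_ to _+ℤ_; _-_ to _-ℤ_)
open import Data.List using (List; []; _∷_; length)
open import Data.Bool using (Bool; true; false; if_then_else_; _∨_)
open import Relation.Nullary.Decidable using (⌊_⌋)
open import Relation.Binary.PropositionalEquality using (_≡_)

data Step : Set where
  U D : Step

-- A lattice path is a finite list of steps, starting at the origin.
Path : Set
Path = List Step

δ : Step → ℤ
δ U = + 1
δ D = ℤ.- (+ 1)

isU : Step → Bool
isU U = true
isU D = false

isD : Step → Bool
isD U = false
isD D = true

_==ℤ_ : ℤ → ℤ → Bool
a ==ℤ b = ⌊ a ℤ.≟ b ⌋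

_≤ℤ_ : ℤ → ℤ → Bool
a ≤ℤ b = ⌊ a ≤? b ⌋

countFrom : (ℤ → Step → Bool) → ℤ → Path → ℕ
countFrom P h [] = 0
countFrom P h (s ∷ x) = (if P h s then 1 else 0) + countFrom P (h +ℤ δ s) x

count : (ℤ → Step → Bool) → Path → ℕ
count P x = countFrom P (+ 0) x

ups : Path → ℕ
ups = count (λ _ s → isU s)

u[_] : ℤ → Path → ℕ
u[ c ] = count (λ h s → isU s Data.Bool.∧ (h ==ℤ c))

d[_] : ℤ → Path → ℕ
d[ c ] = count (λ h s → isD s Data.Bool.∧ (h ==ℤ c))

endH : ℤ → Step → ℤ
endH h s = h +ℤ δ s

below : ℤ → ℤ → Step → Bool
below c h s = (h ≤ℤ c) Data.Bool.∧ (endH h s ≤ℤ c)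

touches : ℤ → ℤ → Step → Bool
touches c h s = (h ==ℤ c) ∨ (endH h s ==ℤ c)

flaws : Path → ℕ
flaws = count (λ h s → isD s Data.Bool.∧ below (+ 0) h s)

-- L_{2k,k}-membership with exactly e flaws: x ∈ D_{2k}^e
InD : ℕ → ℕ → Path → Set
InD k e x = (length x ≡ 2 * k) × (ups x ≡ k) × (flaws x ≡ e)
  where open import Data.Product using (_×_)

-- replaceFrom P n t h x : replace by t the (n+1)-th step (from the left)
-- of x (started at height h) satisfying P; unchanged if no such step.
replaceFrom : (ℤ → Step → Bool) → ℕ → Step → ℤ → Path → Path
replaceFrom P n t h [] = []
replaceFrom P n t h (s ∷ x) with P h s | n
... | true  | zero  = t ∷ x
... | true  | suc m = s ∷ replaceFrom P m t (h +ℤ δ s) x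
... | false | _     = s ∷ replaceFrom P n t (h +ℤ δ s) x

g : Path → Path
g x = replaceFrom (λ h s → isD s Data.Bool.∧ touches (+ 0) h s) (d[ + 0 ] x) U (+ 0) x

-- h: replace by a down-step the u_1(x')-th up-step touching y = 1
-- (if u_1(x') = 0 there is no such step and the path is left unchanged)
hmap : Path → Path
hmap x' with u[ + 1 ] x'
... | zero  = x'
... | suc m = replaceFrom (λ h s → isU s Data.Bool.∧ touches (+ 1) h s) m D (+ 0) x'

f : Path → Path
f x = hmap (g x)

diffCount : Path → Path → ℕ
diffCount [] [] = 0
diffCount [] (_ ∷ y) = suc (diffCount [] y)
diffCount (_ ∷ x) [] = suc (diffCount x [])
diffCount (U ∷ x) (U ∷ y) = diffCount x y
diffCount (D ∷ x) (D ∷ y) = diffCount x y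
diffCount (U ∷ x) (D ∷ y) = suc (diffCount x y)
diffCount (D ∷ x) (U ∷ y) = suc (diffCount x y)

-- g and h each flip one step (D into U, resp. U into D) that starts in the band 0 ≤ y ≤ 1, so x
-- and f x are linked through the path y = g x of L_{2k,k+1}. For a balanced path a D b with a
-- ending in the band, counting the crossings of the lines y = 1/2 and y = −1/2 shows that three
-- excesses coincide: the rank of that D among the down-steps touching y = 0 over d₀, the rank of
-- the U of a U b among the up-steps touching y = 1 over u₁, and the flaws of a D b over the
-- down-steps of a U b starting at height ≤ 1. g flips the step of excess 0 and h the step of
-- excess 1, so f adds exactly one flaw; since either rank condition pins the flipped step down,
-- each flip is determined by either of its two paths, giving injectivity, and can be found from
-- either end, giving surjectivity. The two flipped positions differ because their ranks in y do.
module Submission where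

open import Defs
open import Data.Bool using (Bool; true; false; _∧_; not; if_then_else_)
open import Data.Empty using (⊥-elim)
open import Data.Integer as ℤ using (ℤ; +_; -[1+_]; pred)
open import Data.Integer using () renaming (_+_ to _+ℤ_)
import Data.Integer.Properties as ℤ
open import Algebra.Properties.AbelianGroup ℤ.+-0-abelianGroup using (∙-cancelʳ)
open import Algebra.Properties.CommutativeSemigroup ℤ.+-commutativeSemigroup using ()
  renaming (xy∙z≈xz∙y to +ℤ-xy∙z≈xz∙y)
import Data.Integer.Tactic.RingSolver as ℤ-Solver
open import Data.List using ([]; _∷_; _++_; length)
open import Data.List.Properties using (length-++; ++-assoc; ∷-injective)
open import Data.Nat using (ℕ; zero; suc; _+_; _*_; _≤_; _<_; z≤n; s≤s)
open import Data.Nat.Properties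
open import Algebra.Properties.CommutativeSemigroup +-commutativeSemigroup
  using (interchange; xy∙z≈xz∙y; xy∙z≈x∙zy; x∙yz≈y∙xz; x∙yz≈xz∙y)
import Data.Nat.Tactic.RingSolver as ℕ-Solver
open import Data.Product using (_×_; _,_; ∃; proj₂)
open import Data.Sum using (_⊎_; inj₁; inj₂)
open import Function using (_⇔_; mk⇔)
open import Relation.Nullary using (Dec; ¬_; yes; no)
open import Relation.Nullary.Decidable using (⌊_⌋; isYes≗does; does-⇔; dec-true; dec-false)
open import Relation.Binary.PropositionalEquality

𝟙 : Bool → ℕ
𝟙 b = if b then 1 else 0

isYes-⇔ : ∀ {A B : Set} → A ⇔ B → (a? : Dec A) (b? : Dec B) → ⌊ a? ⌋ ≡ ⌊ b? ⌋
isYes-⇔ A⇔B a? b? = trans (isYes≗does a?) (trans (does-⇔ A⇔B a? b?) (sym (isYes≗does b?)))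

isYes-true : ∀ {A : Set} (a? : Dec A) → A → ⌊ a? ⌋ ≡ true
isYes-true a? a = trans (isYes≗does a?) (dec-true a? a)

isYes-false : ∀ {A : Set} (a? : Dec A) → ¬ A → ⌊ a? ⌋ ≡ false
isYes-false a? ¬a = trans (isYes≗does a?) (dec-false a? ¬a)

i+1≡suc[i] : ∀ i → i +ℤ + 1 ≡ ℤ.suc i
i+1≡suc[i] i = ℤ.+-comm i (+ 1)

i-1≡pred[i] : ∀ i → i +ℤ -[1+ 0 ] ≡ pred i
i-1≡pred[i] i = ℤ.+-comm i -[1+ 0 ]

[i-1]+1≡i : ∀ i → (i +ℤ -[1+ 0 ]) +ℤ + 1 ≡ i
[i-1]+1≡i = ℤ-Solver.solve-∀

+ℤ-cancelʳ-≤ : ∀ {i j} d → i +ℤ d ℤ.≤ j +ℤ d → i ℤ.≤ j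
+ℤ-cancelʳ-≤ {i} {j} d le = subst₂ ℤ._≤_ (undo i d) (undo j d) (ℤ.+-monoˡ-≤ (ℤ.- d) le)
  where
    undo : ∀ i d → (i +ℤ d) ℤ.- d ≡ i
    undo = ℤ-Solver.solve-∀

==ℤ-translate : ∀ i j d → ((i +ℤ d) ==ℤ (j +ℤ d)) ≡ (i ==ℤ j)
==ℤ-translate i j d = isYes-⇔ (mk⇔ (∙-cancelʳ d i j) (cong (_+ℤ d))) _ _

≤ℤ-translate : ∀ i j d → ((i +ℤ d) ≤ℤ (j +ℤ d)) ≡ (i ≤ℤ j)
≤ℤ-translate i j d = isYes-⇔ (mk⇔ (+ℤ-cancelʳ-≤ d) (ℤ.+-monoˡ-≤ d)) _ _

i==ℤi+1≡false : ∀ i → (i ==ℤ (i +ℤ + 1)) ≡ false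
i==ℤi+1≡false i = isYes-false (i ℤ.≟ (i +ℤ + 1)) (λ e → ℤ.i≢suc[i] (trans e (i+1≡suc[i] i)))

i+1==ℤi≡false : ∀ i → ((i +ℤ + 1) ==ℤ i) ≡ false
i+1==ℤi≡false i = isYes-false ((i +ℤ + 1) ℤ.≟ i)
  (λ e → ℤ.i≢suc[i] (sym (trans (sym (i+1≡suc[i] i)) e)))

i-1==ℤj≡i==ℤj+1 : ∀ i j → ((i +ℤ -[1+ 0 ]) ==ℤ j) ≡ (i ==ℤ (j +ℤ + 1))
i-1==ℤj≡i==ℤj+1 i j =
  trans (sym (==ℤ-translate (i +ℤ -[1+ 0 ]) j (+ 1))) (cong (_==ℤ (j +ℤ + 1)) ([i-1]+1≡i i))

i≤ℤi≡true : ∀ i → (i ≤ℤ i) ≡ true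
i≤ℤi≡true i = isYes-true (i ℤ.≤? i) ℤ.≤-refl

i+1≤ℤi≡false : ∀ i → ((i +ℤ + 1) ≤ℤ i) ≡ false
i+1≤ℤi≡false i = isYes-false ((i +ℤ + 1) ℤ.≤? i)
  (λ le → ℤ.<-irrefl refl (ℤ.suc[i]≤j⇒i<j (subst (ℤ._≤ i) (i+1≡suc[i] i) le)))

i≢j⇒i+1≤ℤj≡i≤ℤj : ∀ {i j} → i ≢ j → ((i +ℤ + 1) ≤ℤ j) ≡ (i ≤ℤ j)
i≢j⇒i+1≤ℤj≡i≤ℤj {i} {j} i≢j = isYes-⇔ (mk⇔ weaken strengthen) _ _
  where
    weaken : i +ℤ + 1 ℤ.≤ j → i ℤ.≤ j
    weaken le = ℤ.≤-trans (ℤ.i≤suc[i] i) (subst (ℤ._≤ j) (i+1≡suc[i] i) le)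
    strengthen : i ℤ.≤ j → i +ℤ + 1 ℤ.≤ j
    strengthen le = subst (ℤ._≤ j) (sym (i+1≡suc[i] i)) (ℤ.i<j⇒suc[i]≤j (ℤ.≤∧≢⇒< le i≢j))

i≢j+1⇒i≤ℤj+1≡i≤ℤj : ∀ {i j} → i ≢ j +ℤ + 1 → (i ≤ℤ (j +ℤ + 1)) ≡ (i ≤ℤ j)
i≢j+1⇒i≤ℤj+1≡i≤ℤj {i} {j} i≢j+1 = isYes-⇔ (mk⇔ strengthen weaken) _ _
  where
    strengthen : i ℤ.≤ j +ℤ + 1 → i ℤ.≤ j
    strengthen le = subst (i ℤ.≤_) (trans (cong pred (i+1≡suc[i] j)) (ℤ.pred-suc j))
      (ℤ.i<j⇒i≤pred[j] (ℤ.≤∧≢⇒< le i≢j+1))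
    weaken : i ℤ.≤ j → i ℤ.≤ j +ℤ + 1
    weaken le = subst (i ℤ.≤_) (sym (i+1≡suc[i] j)) (ℤ.i≤j⇒i≤1+j le)

i≤j⇒i-1≤ℤj≡true : ∀ {i j} → i ℤ.≤ j → ((i +ℤ -[1+ 0 ]) ≤ℤ j) ≡ true
i≤j⇒i-1≤ℤj≡true {i} {j} le =
  isYes-true _ (subst (ℤ._≤ j) (sym (i-1≡pred[i] i)) (ℤ.i≤j⇒pred[i]≤j le))

i-1≤ℤj≡i≤ℤj+1 : ∀ i j → ((i +ℤ -[1+ 0 ]) ≤ℤ j) ≡ (i ≤ℤ (j +ℤ + 1))
i-1≤ℤj≡i≤ℤj+1 i j =
  trans (sym (≤ℤ-translate (i +ℤ -[1+ 0 ]) j (+ 1))) (cong (_≤ℤ (j +ℤ + 1)) ([i-1]+1≡i i))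

StepPredicate : Set
StepPredicate = ℤ → Step → Bool

upAt downAt downAtMost downBelow touchingUp touchingDown : ℤ → StepPredicate
upAt c h s = isU s ∧ (h ==ℤ c)
downAt c h s = isD s ∧ (h ==ℤ c)
downAtMost c h s = isD s ∧ (h ≤ℤ c)
downBelow c h s = isD s ∧ below c h s
touchingUp c h s = isU s ∧ touches c h s
touchingDown c h s = isD s ∧ touches c h s

above : ℤ → ℤ → Bool
above c h = not (h ≤ℤ c)

touchingDown-split : ∀ c h s →
  𝟙 (touchingDown c h s) ≡ 𝟙 (downAt c h s) + 𝟙 (downAt (c +ℤ + 1) h s)
touchingDown-split c h U = refl
touchingDown-split c h D rewrite i-1==ℤj≡i==ℤj+1 h c with h ℤ.≟ c
... | yes refl rewrite i==ℤi+1≡false h = refl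
... | no _ = refl

touchingUp-split : ∀ c h s →
  𝟙 (touchingUp (c +ℤ + 1) h s) ≡ 𝟙 (upAt c h s) + 𝟙 (upAt (c +ℤ + 1) h s)
touchingUp-split c h D = refl
touchingUp-split c h U rewrite ==ℤ-translate h c (+ 1) with h ℤ.≟ c +ℤ + 1
... | yes refl rewrite i+1==ℤi≡false c = refl
... | no _ = sym (+-identityʳ _)

downBelow≡downAtMost : ∀ c h s → downBelow c h s ≡ downAtMost c h s
downBelow≡downAtMost c h U = refl
downBelow≡downAtMost c h D with h ℤ.≤? c
... | yes le = i≤j⇒i-1≤ℤj≡true le
... | no _ = refl

downAtMost-split : ∀ c h s →
  𝟙 (downAtMost (c +ℤ + 1) h s) ≡ 𝟙 (downAtMost c h s) + 𝟙 (downAt (c +ℤ + 1) h s)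
downAtMost-split c h U = refl
downAtMost-split c h D with h ℤ.≟ c +ℤ + 1
... | yes refl rewrite i≤ℤi≡true (c +ℤ + 1) | i+1≤ℤi≡false c = refl
... | no h≢c+1 rewrite i≢j+1⇒i≤ℤj+1≡i≤ℤj {h} {c} h≢c+1 = sym (+-identityʳ _)

upAt-translate : ∀ c d h s → upAt (c +ℤ d) (h +ℤ d) s ≡ upAt c h s
upAt-translate c d h s = cong (isU s ∧_) (==ℤ-translate h c d)

downAtMost-translate : ∀ c d h s → downAtMost (c +ℤ d) (h +ℤ d) s ≡ downAtMost c h s
downAtMost-translate c d h s = cong (isD s ∧_) (≤ℤ-translate h c d)

crossing-step : ∀ c h s →
  𝟙 (upAt c h s) + 𝟙 (above c h) ≡ 𝟙 (downAt (c +ℤ + 1) h s) + 𝟙 (above c (h +ℤ δ s))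
crossing-step c h U with h ℤ.≟ c
... | yes refl rewrite i≤ℤi≡true h | i+1≤ℤi≡false h = refl
... | no h≢c rewrite i≢j⇒i+1≤ℤj≡i≤ℤj {h} {c} h≢c = refl
crossing-step c h D rewrite i-1≤ℤj≡i≤ℤj+1 h c with h ℤ.≟ c +ℤ + 1
... | yes refl rewrite i≤ℤi≡true (c +ℤ + 1) | i+1≤ℤi≡false c = refl
... | no h≢c+1 rewrite i≢j+1⇒i≤ℤj+1≡i≤ℤj {h} {c} h≢c+1 = refl

InBand : ℤ → Set
InBand t = t ≡ + 0 ⊎ t ≡ + 1

touchingDown-inBand : ∀ h s → touchingDown (+ 0) h s ≡ true → s ≡ D × InBand h
touchingDown-inBand h U ()
touchingDown-inBand h D _ with h ℤ.≟ + 0 | (h +ℤ -[1+ 0 ]) ℤ.≟ + 0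
... | yes h≡0 | _ = refl , inj₁ h≡0
... | no _ | yes h-1≡0 = refl , inj₂ (∙-cancelʳ -[1+ 0 ] h (+ 1) h-1≡0)
touchingDown-inBand h D () | no _ | no _

touchingUp-inBand : ∀ h s → touchingUp (+ 1) h s ≡ true → s ≡ U × InBand h
touchingUp-inBand h D ()
touchingUp-inBand h U _ with h ℤ.≟ + 1 | (h +ℤ + 1) ℤ.≟ + 1
... | yes h≡1 | _ = refl , inj₂ h≡1
... | no _ | yes h+1≡1 = refl , inj₁ (∙-cancelʳ (+ 1) h (+ 0) h+1≡1)
touchingUp-inBand h U () | no _ | no _

inBand-touchingDown : ∀ h → InBand h → touchingDown (+ 0) h D ≡ true
inBand-touchingDown _ (inj₁ refl) = refl
inBand-touchingDown _ (inj₂ refl) = refl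

inBand-touchingUp : ∀ h → InBand h → touchingUp (+ 1) h U ≡ true
inBand-touchingUp _ (inj₁ refl) = refl
inBand-touchingUp _ (inj₂ refl) = refl

-- Counting steps along a path

endHeight : ℤ → Path → ℤ
endHeight h [] = h
endHeight h (s ∷ x) = endHeight (h +ℤ δ s) x

endHeight-++ : ∀ h a b → endHeight h (a ++ b) ≡ endHeight (endHeight h a) b
endHeight-++ h [] b = refl
endHeight-++ h (s ∷ a) b = endHeight-++ (h +ℤ δ s) a b

endHeight-translate : ∀ d h x → endHeight (h +ℤ d) x ≡ endHeight h x +ℤ d
endHeight-translate d h [] = refl
endHeight-translate d h (s ∷ x) =
  trans (cong (λ h′ → endHeight h′ x) (+ℤ-xy∙z≈xz∙y h d (δ s))) (endHeight-translate d (h +ℤ δ s) x)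

countFrom-++ : ∀ (P : StepPredicate) h a b →
  countFrom P h (a ++ b) ≡ countFrom P h a + countFrom P (endHeight h a) b
countFrom-++ P h [] b = refl
countFrom-++ P h (s ∷ a) b =
  trans (cong (_+_ (𝟙 (P h s))) (countFrom-++ P (h +ℤ δ s) a b)) (sym (+-assoc (𝟙 (P h s)) _ _))

countFrom-cong : ∀ {P Q : StepPredicate} → (∀ h s → P h s ≡ Q h s) →
  ∀ h x → countFrom P h x ≡ countFrom Q h x
countFrom-cong P≗Q h [] = refl
countFrom-cong P≗Q h (s ∷ x) = cong₂ _+_ (cong 𝟙 (P≗Q h s)) (countFrom-cong P≗Q (h +ℤ δ s) x)

countFrom-split : ∀ {P Q R : StepPredicate} → (∀ h s → 𝟙 (P h s) ≡ 𝟙 (Q h s) + 𝟙 (R h s)) →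
  ∀ h x → countFrom P h x ≡ countFrom Q h x + countFrom R h x
countFrom-split split h [] = refl
countFrom-split {Q = Q} {R} split h (s ∷ x) =
  trans (cong₂ _+_ (split h s) (countFrom-split split (h +ℤ δ s) x))
        (interchange (𝟙 (Q h s)) (𝟙 (R h s)) _ _)

countFrom-translate : ∀ {P Q : StepPredicate} d → (∀ h s → P (h +ℤ d) s ≡ Q h s) →
  ∀ h x → countFrom P (h +ℤ d) x ≡ countFrom Q h x
countFrom-translate d P≗Q h [] = refl
countFrom-translate {P} d P≗Q h (s ∷ x) = cong₂ _+_ (cong 𝟙 (P≗Q h s))
  (trans (cong (λ h′ → countFrom P h′ x) (+ℤ-xy∙z≈xz∙y h d (δ s)))
         (countFrom-translate d P≗Q (h +ℤ δ s) x))

countFrom-heightless : ∀ (p : Step → Bool) h h′ x →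
  countFrom (λ _ → p) h x ≡ countFrom (λ _ → p) h′ x
countFrom-heightless p h h′ [] = refl
countFrom-heightless p h h′ (s ∷ x) = cong (_+_ (𝟙 (p s))) (countFrom-heightless p _ _ x)

-- Up-steps from height c and down-steps from height c + 1 are the crossings of y = c + 1/2,
-- which alternate in direction.
crossings : ∀ c h x → countFrom (upAt c) h x + 𝟙 (above c h)
                    ≡ countFrom (downAt (c +ℤ + 1)) h x + 𝟙 (above c (endHeight h x))
crossings c h [] = refl
crossings c h (s ∷ x) = begin
  (u + us) + 𝟙 (above c h)         ≡⟨ xy∙z≈xz∙y u us _ ⟩
  (u + 𝟙 (above c h)) + us         ≡⟨ cong (_+ us) (crossing-step c h s) ⟩
  (d + 𝟙 (above c h′)) + us        ≡⟨ xy∙z≈x∙zy d _ us ⟩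
  d + (us + 𝟙 (above c h′))        ≡⟨ cong (_+_ d) (crossings c h′ x) ⟩
  d + (ds + 𝟙 (above c (endHeight h′ x))) ≡⟨ sym (+-assoc d ds _) ⟩
  (d + ds) + 𝟙 (above c (endHeight h′ x)) ∎
  where
    open ≡-Reasoning
    h′ = h +ℤ δ s
    u = 𝟙 (upAt c h s)
    d = 𝟙 (downAt (c +ℤ + 1) h s)
    us = countFrom (upAt c) h′ x
    ds = countFrom (downAt (c +ℤ + 1)) h′ x

crossings-to : ∀ c h x {e} → endHeight h x ≡ e →
  countFrom (upAt c) h x + 𝟙 (above c h) ≡ countFrom (downAt (c +ℤ + 1)) h x + 𝟙 (above c e)
crossings-to c h x refl = crossings c h x

downs : Path → ℕ
downs = count (λ _ → isD)

ups+downs≡length : ∀ h x → countFrom (λ _ → isU) h x + countFrom (λ _ → isD) h x ≡ length x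
ups+downs≡length h [] = refl
ups+downs≡length h (U ∷ x) = cong suc (ups+downs≡length _ x)
ups+downs≡length h (D ∷ x) = trans (+-suc _ _) (cong suc (ups+downs≡length _ x))

endHeight+downs≡ups : ∀ h x →
  endHeight h x +ℤ + countFrom (λ _ → isD) h x ≡ h +ℤ + countFrom (λ _ → isU) h x
endHeight+downs≡ups h [] = refl
endHeight+downs≡ups h (U ∷ x) = trans (endHeight+downs≡ups (h +ℤ + 1) x) (ℤ.+-assoc h (+ 1) _)
endHeight+downs≡ups h (D ∷ x) = begin
  e +ℤ (+ 1 +ℤ n) ≡⟨ shuffle e n ⟩
  (e +ℤ n) +ℤ + 1 ≡⟨ cong (_+ℤ + 1) (endHeight+downs≡ups (h +ℤ -[1+ 0 ]) x) ⟩
  ((h +ℤ -[1+ 0 ]) +ℤ + countFrom (λ _ → isU) (h +ℤ -[1+ 0 ]) x) +ℤ + 1 ≡⟨ cancel h _ ⟩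
  h +ℤ + countFrom (λ _ → isU) (h +ℤ -[1+ 0 ]) x ∎
  where
    open ≡-Reasoning
    e = endHeight (h +ℤ -[1+ 0 ]) x
    n = + countFrom (λ _ → isD) (h +ℤ -[1+ 0 ]) x
    shuffle : ∀ e n → e +ℤ (+ 1 +ℤ n) ≡ (e +ℤ n) +ℤ + 1
    shuffle = ℤ-Solver.solve-∀
    cancel : ∀ h u → ((h +ℤ -[1+ 0 ]) +ℤ u) +ℤ + 1 ≡ h +ℤ u
    cancel = ℤ-Solver.solve-∀

downs-balanced : ∀ {k} x → length x ≡ 2 * k → ups x ≡ k → downs x ≡ k
downs-balanced {k} x len up = +-cancelˡ-≡ k _ _ (begin
  k + downs x      ≡⟨ cong (_+ downs x) (sym up) ⟩
  ups x + downs x  ≡⟨ ups+downs≡length (+ 0) x ⟩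
  length x         ≡⟨ len ⟩
  k + (k + 0)      ≡⟨ cong (_+_ k) (+-identityʳ k) ⟩
  k + k            ∎)
  where open ≡-Reasoning

endHeight-balanced : ∀ {k} x → length x ≡ 2 * k → ups x ≡ k → endHeight (+ 0) x ≡ + 0
endHeight-balanced {k} x len up = ∙-cancelʳ (+ k) _ _ (begin
  endHeight (+ 0) x +ℤ + k
    ≡⟨ cong (λ n → endHeight (+ 0) x +ℤ + n) (sym (downs-balanced x len up)) ⟩
  endHeight (+ 0) x +ℤ + downs x  ≡⟨ endHeight+downs≡ups (+ 0) x ⟩
  + 0 +ℤ + ups x                  ≡⟨ cong (λ n → + 0 +ℤ + n) up ⟩
  + 0 +ℤ + k                      ∎)
  where open ≡-Reasoning

length-flip : ∀ (a b : Path) → length (a ++ U ∷ b) ≡ length (a ++ D ∷ b)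
length-flip a b = trans (length-++ a) (sym (length-++ a))

ups-flip : ∀ a b → ups (a ++ U ∷ b) ≡ suc (ups (a ++ D ∷ b))
ups-flip a b = begin
  ups (a ++ U ∷ b)
    ≡⟨ countFrom-++ _ (+ 0) a (U ∷ b) ⟩
  ups a + suc (countFrom (λ _ → isU) (t +ℤ + 1) b)
    ≡⟨ cong (λ n → ups a + suc n) (countFrom-heightless isU _ _ b) ⟩
  ups a + suc (countFrom (λ _ → isU) (t +ℤ -[1+ 0 ]) b)
    ≡⟨ +-suc (ups a) _ ⟩
  suc (ups a + countFrom (λ _ → isU) (t +ℤ -[1+ 0 ]) b)
    ≡⟨ cong suc (sym (countFrom-++ _ (+ 0) a (D ∷ b))) ⟩
  suc (ups (a ++ D ∷ b)) ∎
  where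
    open ≡-Reasoning
    t = endHeight (+ 0) a

endHeight-flip : ∀ h a b → endHeight h (a ++ U ∷ b) ≡ endHeight h (a ++ D ∷ b) +ℤ + 2
endHeight-flip h a b = begin
  endHeight h (a ++ U ∷ b)              ≡⟨ endHeight-++ h a (U ∷ b) ⟩
  endHeight (t +ℤ + 1) b                ≡⟨ cong (λ h′ → endHeight h′ b) (up≡down+2 t) ⟩
  endHeight ((t +ℤ -[1+ 0 ]) +ℤ + 2) b  ≡⟨ endHeight-translate (+ 2) (t +ℤ -[1+ 0 ]) b ⟩
  endHeight (t +ℤ -[1+ 0 ]) b +ℤ + 2    ≡⟨ cong (_+ℤ + 2) (sym (endHeight-++ h a (D ∷ b))) ⟩
  endHeight h (a ++ D ∷ b) +ℤ + 2       ∎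
  where
    open ≡-Reasoning
    t = endHeight h a
    up≡down+2 : ∀ t → t +ℤ + 1 ≡ (t +ℤ -[1+ 0 ]) +ℤ + 2
    up≡down+2 = ℤ-Solver.solve-∀

endHeight-lower : ∀ a b → endHeight (+ 0) (a ++ U ∷ b) ≡ + 2 → endHeight (+ 0) (a ++ D ∷ b) ≡ + 0
endHeight-lower a b end≡2 = ∙-cancelʳ (+ 2) _ (+ 0) (trans (sym (endHeight-flip (+ 0) a b)) end≡2)

-- Occurrences of marked steps

record Occurrence (P : StepPredicate) (n : ℕ) (h : ℤ) (x : Path) : Set where
  constructor occurrence
  field
    before : Path
    step : Step
    after : Path
    splits : x ≡ before ++ step ∷ after
    rank : countFrom P h before ≡ n
    marked : P (endHeight h before) step ≡ true

nthOccurrence : ∀ (P : StepPredicate) n h x → n < countFrom P h x → Occurrence P n h x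
nthOccurrence P n h (s ∷ x) lt with P h s in marked
nthOccurrence P zero h (s ∷ x) lt | true = occurrence [] s x refl refl marked
nthOccurrence P (suc n) h (s ∷ x) lt | true with nthOccurrence P n (h +ℤ δ s) x (≤-pred lt)
... | occurrence a t b x≡ rank t-marked =
  occurrence (s ∷ a) t b (cong (s ∷_) x≡)
    (trans (cong (λ m → 𝟙 m + countFrom P (h +ℤ δ s) a) marked) (cong suc rank)) t-marked
nthOccurrence P n h (s ∷ x) lt | false with nthOccurrence P n (h +ℤ δ s) x lt
... | occurrence a t b x≡ rank t-marked =
  occurrence (s ∷ a) t b (cong (s ∷_) x≡)
    (trans (cong (λ m → 𝟙 m + countFrom P (h +ℤ δ s) a) marked) rank) t-marked

occurrence-unique : ∀ (P : StepPredicate) h a s b a′ s′ b′ → a ++ s ∷ b ≡ a′ ++ s′ ∷ b′ →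
  P (endHeight h a) s ≡ true → P (endHeight h a′) s′ ≡ true → countFrom P h a ≡ countFrom P h a′ →
  a ≡ a′ × b ≡ b′
occurrence-unique P h [] s b [] s′ b′ eq _ _ _ = refl , proj₂ (∷-injective eq)
occurrence-unique P h [] s b (t ∷ a′) s′ b′ eq marked _ ranks with ∷-injective eq
... | refl , _ rewrite marked = ⊥-elim (0≢1+n ranks)
occurrence-unique P h (t ∷ a) s b [] s′ b′ eq _ marked′ ranks with ∷-injective eq
... | refl , _ rewrite marked′ = ⊥-elim (0≢1+n (sym ranks))
occurrence-unique P h (t ∷ a) s b (t′ ∷ a′) s′ b′ eq marked marked′ ranks with ∷-injective eq
... | refl , eq′ with occurrence-unique P (h +ℤ δ t) a s b a′ s′ b′ eq′ marked marked′
                        (+-cancelˡ-≡ (𝟙 (P h t)) _ _ ranks)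
...   | refl , refl = refl , refl

lowerRank⇒prefix : ∀ (P : StepPredicate) h a s b a′ s′ b′ → a ++ s ∷ b ≡ a′ ++ s′ ∷ b′ →
  countFrom P h a′ < countFrom P h a → ∃ λ w → a ≡ a′ ++ s′ ∷ w × b′ ≡ w ++ s ∷ b
lowerRank⇒prefix P h (t ∷ a) s b [] s′ b′ eq lt with ∷-injective eq
... | refl , eq′ = a , refl , sym eq′
lowerRank⇒prefix P h (t ∷ a) s b (t′ ∷ a′) s′ b′ eq lt with ∷-injective eq
... | refl , eq′ with lowerRank⇒prefix P (h +ℤ δ t) a s b a′ s′ b′ eq′
                        (+-cancelˡ-< (𝟙 (P h t)) _ _ lt)
...   | w , refl , refl = w , refl , refl

replaceFrom-occurrence : ∀ (P : StepPredicate) n t h a s b → countFrom P h a ≡ n →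
  P (endHeight h a) s ≡ true → replaceFrom P n t h (a ++ s ∷ b) ≡ a ++ t ∷ b
replaceFrom-occurrence P n t h [] s b rank marked with P h s | marked
replaceFrom-occurrence P zero t h [] s b rank marked | true | _ = refl
replaceFrom-occurrence P n t h (s′ ∷ a) s b rank marked with P h s′
replaceFrom-occurrence P (suc n) t h (s′ ∷ a) s b rank marked | true =
  cong (s′ ∷_) (replaceFrom-occurrence P n t _ a s b (suc-injective rank) marked)
replaceFrom-occurrence P n t h (s′ ∷ a) s b rank marked | false =
  cong (s′ ∷_) (replaceFrom-occurrence P n t _ a s b rank marked)

diffCount-refl : ∀ x → diffCount x x ≡ 0
diffCount-refl [] = refl
diffCount-refl (U ∷ x) = diffCount-refl x
diffCount-refl (D ∷ x) = diffCount-refl x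

diffCount-++ˡ : ∀ a x y → diffCount (a ++ x) (a ++ y) ≡ diffCount x y
diffCount-++ˡ [] x y = refl
diffCount-++ˡ (U ∷ a) x y = diffCount-++ˡ a x y
diffCount-++ˡ (D ∷ a) x y = diffCount-++ˡ a x y

diffCount-swap : ∀ a w b → diffCount ((a ++ U ∷ w) ++ D ∷ b) (a ++ D ∷ (w ++ U ∷ b)) ≡ 2
diffCount-swap a w b rewrite ++-assoc a (U ∷ w) (D ∷ b)
  | diffCount-++ˡ a (U ∷ (w ++ D ∷ b)) (D ∷ (w ++ U ∷ b))
  | diffCount-++ˡ w (D ∷ b) (U ∷ b) | diffCount-refl b = refl

-- Steps touching the lines y = 0 and y = 1

touchingDowns≡d[0]+d[1] : ∀ x → count (touchingDown (+ 0)) x ≡ d[ + 0 ] x + d[ + 1 ] x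
touchingDowns≡d[0]+d[1] = countFrom-split (touchingDown-split (+ 0)) (+ 0)

touchingUps≡u[0]+u[1] : ∀ x → count (touchingUp (+ 1)) x ≡ u[ + 0 ] x + u[ + 1 ] x
touchingUps≡u[0]+u[1] = countFrom-split (touchingUp-split (+ 0)) (+ 0)

touchingDowns+above≡d[0]+u[0] : ∀ x →
  count (touchingDown (+ 0)) x + 𝟙 (above (+ 0) (endHeight (+ 0) x)) ≡ d[ + 0 ] x + u[ + 0 ] x
touchingDowns+above≡d[0]+u[0] x = begin
  count (touchingDown (+ 0)) x + γ  ≡⟨ cong (_+ γ) (touchingDowns≡d[0]+d[1] x) ⟩
  (d[ + 0 ] x + d[ + 1 ] x) + γ     ≡⟨ +-assoc (d[ + 0 ] x) _ γ ⟩
  d[ + 0 ] x + (d[ + 1 ] x + γ)     ≡⟨ cong (_+_ (d[ + 0 ] x)) (sym (crossings (+ 0) (+ 0) x)) ⟩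
  d[ + 0 ] x + (u[ + 0 ] x + 0)     ≡⟨ cong (_+_ (d[ + 0 ] x)) (+-identityʳ _) ⟩
  d[ + 0 ] x + u[ + 0 ] x           ∎
  where
    open ≡-Reasoning
    γ = 𝟙 (above (+ 0) (endHeight (+ 0) x))

crossings-raised : ∀ r b → endHeight r b ≡ + 0 →
  countFrom (upAt (+ 1)) (r +ℤ + 2) b + 𝟙 (above -[1+ 0 ] r) ≡ countFrom (downAt (+ 0)) r b + 1
crossings-raised r b end≡0 = begin
  countFrom (upAt (+ 1)) (r +ℤ + 2) b + 𝟙 (above -[1+ 0 ] r)
    ≡⟨ cong (_+ 𝟙 (above -[1+ 0 ] r))
            (countFrom-translate {P = upAt (+ 1)} (+ 2) (upAt-translate -[1+ 0 ] (+ 2)) r b) ⟩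
  countFrom (upAt -[1+ 0 ]) r b + 𝟙 (above -[1+ 0 ] r)
    ≡⟨ crossings-to -[1+ 0 ] r b end≡0 ⟩
  countFrom (downAt (+ 0)) r b + 1 ∎
  where open ≡-Reasoning

touchRanks-tail : ∀ t b → InBand t → endHeight (t +ℤ -[1+ 0 ]) b ≡ + 0 →
  countFrom (upAt (+ 1)) t (U ∷ b) ≡ countFrom (downAt (+ 0)) t (D ∷ b) + 𝟙 (above (+ 0) t)
touchRanks-tail _ b (inj₁ refl) end≡0 = begin
  countFrom (upAt (+ 1)) (+ 1) b           ≡⟨ sym (+-identityʳ _) ⟩
  countFrom (upAt (+ 1)) (+ 1) b + 0       ≡⟨ crossings-raised -[1+ 0 ] b end≡0 ⟩
  countFrom (downAt (+ 0)) -[1+ 0 ] b + 1  ≡⟨ +-comm _ 1 ⟩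
  suc (countFrom (downAt (+ 0)) -[1+ 0 ] b) ≡⟨ sym (+-identityʳ _) ⟩
  suc (countFrom (downAt (+ 0)) -[1+ 0 ] b) + 0 ∎
  where open ≡-Reasoning
touchRanks-tail _ b (inj₂ refl) end≡0 = trans (+-comm 1 _) (crossings-raised (+ 0) b end≡0)

downAtMost-raised : ∀ r b → countFrom (downAtMost (+ 0)) r b
  ≡ countFrom (downAtMost (+ 1)) (r +ℤ + 2) b + countFrom (downAt (+ 0)) r b
downAtMost-raised r b = trans (countFrom-split (downAtMost-split -[1+ 0 ]) r b)
  (cong (_+ countFrom (downAt (+ 0)) r b)
    (sym (countFrom-translate {P = downAtMost (+ 1)} (+ 2) (downAtMost-translate -[1+ 0 ] (+ 2)) r b)))

flaws-tail : ∀ t b → InBand t → countFrom (downAtMost (+ 0)) t (D ∷ b)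
  ≡ countFrom (downAtMost (+ 1)) t (U ∷ b) + countFrom (downAt (+ 0)) t (D ∷ b)
flaws-tail _ b (inj₁ refl) = trans (cong suc (downAtMost-raised -[1+ 0 ] b)) (sym (+-suc _ _))
flaws-tail _ b (inj₂ refl) = downAtMost-raised (+ 0) b

touchRanks-flip : ∀ a b → InBand (endHeight (+ 0) a) → endHeight (+ 0) (a ++ D ∷ b) ≡ + 0 →
  count (touchingDown (+ 0)) a + u[ + 1 ] (a ++ U ∷ b) ≡ count (touchingUp (+ 1)) a + d[ + 0 ] (a ++ D ∷ b)
touchRanks-flip a b band end≡0 = begin
  T + u[ + 1 ] (a ++ U ∷ b)
    ≡⟨ cong (_+_ T) (countFrom-++ (upAt (+ 1)) (+ 0) a (U ∷ b)) ⟩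
  T + (u₁ + countFrom (upAt (+ 1)) t (U ∷ b))
    ≡⟨ cong (λ n → T + (u₁ + n))
            (touchRanks-tail t b band (trans (sym (endHeight-++ (+ 0) a (D ∷ b))) end≡0)) ⟩
  T + (u₁ + (D′ + γ))               ≡⟨ rearrange T u₁ D′ γ ⟩
  (T + γ) + (u₁ + D′)               ≡⟨ cong (_+ (u₁ + D′)) (touchingDowns+above≡d[0]+u[0] a) ⟩
  (d₀ + u₀) + (u₁ + D′)             ≡⟨ regroup d₀ u₀ u₁ D′ ⟩
  (u₀ + u₁) + (d₀ + D′)
    ≡⟨ sym (cong₂ _+_ (touchingUps≡u[0]+u[1] a) (countFrom-++ (downAt (+ 0)) (+ 0) a (D ∷ b))) ⟩
  count (touchingUp (+ 1)) a + d[ + 0 ] (a ++ D ∷ b) ∎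
  where
    open ≡-Reasoning
    t = endHeight (+ 0) a
    T = count (touchingDown (+ 0)) a
    γ = 𝟙 (above (+ 0) t)
    D′ = countFrom (downAt (+ 0)) t (D ∷ b)
    d₀ = d[ + 0 ] a
    u₀ = u[ + 0 ] a
    u₁ = u[ + 1 ] a
    rearrange : ∀ p u d γ → p + (u + (d + γ)) ≡ (p + γ) + (u + d)
    rearrange = ℕ-Solver.solve-∀
    regroup : ∀ d₀ u₀ u₁ d → (d₀ + u₀) + (u₁ + d) ≡ (u₀ + u₁) + (d₀ + d)
    regroup = ℕ-Solver.solve-∀

flaws-flip : ∀ a b → InBand (endHeight (+ 0) a) →
  flaws (a ++ D ∷ b) + count (touchingDown (+ 0)) a
    ≡ count (downAtMost (+ 1)) (a ++ U ∷ b) + d[ + 0 ] (a ++ D ∷ b)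
flaws-flip a b band = begin
  flaws (a ++ D ∷ b) + count (touchingDown (+ 0)) a
    ≡⟨ cong₂ _+_ flaws≡ (touchingDowns≡d[0]+d[1] a) ⟩
  (L₀ + countFrom (downAtMost (+ 0)) t (D ∷ b)) + (d₀ + d₁)
    ≡⟨ cong (λ n → (L₀ + n) + (d₀ + d₁)) (flaws-tail t b band) ⟩
  (L₀ + (S + D′)) + (d₀ + d₁)        ≡⟨ regroup L₀ S D′ d₀ d₁ ⟩
  ((L₀ + d₁) + S) + (d₀ + D′)
    ≡⟨ sym (cong₂ _+_ lowDowns≡ (countFrom-++ (downAt (+ 0)) (+ 0) a (D ∷ b))) ⟩
  count (downAtMost (+ 1)) (a ++ U ∷ b) + d[ + 0 ] (a ++ D ∷ b) ∎
  where
    open ≡-Reasoning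
    t = endHeight (+ 0) a
    L₀ = count (downAtMost (+ 0)) a
    S = countFrom (downAtMost (+ 1)) t (U ∷ b)
    D′ = countFrom (downAt (+ 0)) t (D ∷ b)
    d₀ = d[ + 0 ] a
    d₁ = d[ + 1 ] a
    flaws≡ : flaws (a ++ D ∷ b) ≡ L₀ + countFrom (downAtMost (+ 0)) t (D ∷ b)
    flaws≡ = trans (countFrom-cong (downBelow≡downAtMost (+ 0)) (+ 0) (a ++ D ∷ b))
                   (countFrom-++ (downAtMost (+ 0)) (+ 0) a (D ∷ b))
    lowDowns≡ : count (downAtMost (+ 1)) (a ++ U ∷ b) ≡ (L₀ + d₁) + S
    lowDowns≡ = trans (countFrom-++ (downAtMost (+ 1)) (+ 0) a (U ∷ b))
                      (cong (_+ S) (countFrom-split (downAtMost-split (+ 0)) (+ 0) a))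
    regroup : ∀ l s d d₀ d₁ → (l + (s + d)) + (d₀ + d₁) ≡ ((l + d₁) + s) + (d₀ + d)
    regroup = ℕ-Solver.solve-∀

mutual
  u[0]≡0⇒flaws≡downs : ∀ x → u[ + 0 ] x ≡ 0 → flaws x ≡ downs x
  u[0]≡0⇒flaws≡downs [] _ = refl
  u[0]≡0⇒flaws≡downs (D ∷ x) none = cong suc (u[0]≡0⇒flaws≡downs⁻ 0 x none)

  u[0]≡0⇒flaws≡downs⁻ : ∀ n x → countFrom (upAt (+ 0)) -[1+ n ] x ≡ 0 →
    countFrom (downBelow (+ 0)) -[1+ n ] x ≡ countFrom (λ _ → isD) -[1+ n ] x
  u[0]≡0⇒flaws≡downs⁻ n [] _ = refl
  u[0]≡0⇒flaws≡downs⁻ n (D ∷ x) none = cong suc (u[0]≡0⇒flaws≡downs⁻ _ x none)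
  u[0]≡0⇒flaws≡downs⁻ zero (U ∷ x) none = u[0]≡0⇒flaws≡downs x none
  u[0]≡0⇒flaws≡downs⁻ (suc n) (U ∷ x) none = u[0]≡0⇒flaws≡downs⁻ n x none

d[0]≡0⇒noFlaws : ∀ n x → countFrom (downAt (+ 0)) (+ n) x ≡ 0 → countFrom (downBelow (+ 0)) (+ n) x ≡ 0
d[0]≡0⇒noFlaws n [] _ = refl
d[0]≡0⇒noFlaws (suc n) (D ∷ x) none = d[0]≡0⇒noFlaws n x none
d[0]≡0⇒noFlaws n (U ∷ x) none = d[0]≡0⇒noFlaws _ x none

d[0]<touchingDowns : ∀ x → endHeight (+ 0) x ≡ + 0 → flaws x < downs x →
  d[ + 0 ] x < count (touchingDown (+ 0)) x
d[0]<touchingDowns x end≡0 fl<dn = begin-strict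
  d[ + 0 ] x                       <⟨ m<m+n (d[ + 0 ] x) 0<u₀ ⟩
  d[ + 0 ] x + u[ + 0 ] x          ≡⟨ sym (touchingDowns+above≡d[0]+u[0] x) ⟩
  T + 𝟙 (above (+ 0) (endHeight (+ 0) x)) ≡⟨ cong (λ e → T + 𝟙 (above (+ 0) e)) end≡0 ⟩
  T + 0                            ≡⟨ +-identityʳ T ⟩
  T                                ∎
  where
    open ≤-Reasoning
    T = count (touchingDown (+ 0)) x
    0<u₀ : 0 < u[ + 0 ] x
    0<u₀ = n≢0⇒n>0 (λ u₀≡0 → <-irrefl (u[0]≡0⇒flaws≡downs x u₀≡0) fl<dn)

d[0]≤touchingDowns : ∀ x → d[ + 0 ] x ≤ count (touchingDown (+ 0)) x
d[0]≤touchingDowns x = subst (d[ + 0 ] x ≤_) (sym (touchingDowns≡d[0]+d[1] x)) (m≤m+n _ _)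

0<flaws⇒0<d[0] : ∀ x → 0 < flaws x → 0 < d[ + 0 ] x
0<flaws⇒0<d[0] x flawed = n≢0⇒n>0 (λ d₀≡0 → <-irrefl (sym (d[0]≡0⇒noFlaws 0 x d₀≡0)) flawed)

u[1]≡1+d[2] : ∀ y → endHeight (+ 0) y ≡ + 2 → u[ + 1 ] y ≡ suc (d[ + 2 ] y)
u[1]≡1+d[2] y end≡2 = trans (sym (+-identityʳ _)) (trans (crossings-to (+ 1) (+ 0) y end≡2) (+-comm _ 1))

u[1]<touchingUps : ∀ y → endHeight (+ 0) y ≡ + 2 → u[ + 1 ] y < count (touchingUp (+ 1)) y
u[1]<touchingUps y end≡2 = subst (u[ + 1 ] y <_) (sym (touchingUps≡u[0]+u[1] y)) u₁<u₀+u₁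
  where
    u₀≡ : u[ + 0 ] y ≡ suc (d[ + 1 ] y)
    u₀≡ = trans (sym (+-identityʳ _)) (trans (crossings-to (+ 0) (+ 0) y end≡2) (+-comm _ 1))
    u₁<u₀+u₁ : u[ + 1 ] y < u[ + 0 ] y + u[ + 1 ] y
    u₁<u₀+u₁ rewrite u₀≡ = s≤s (m≤n+m _ _)

-- Flipping one step

rank-transfer : ∀ {p q u d j} → p + u ≡ q + d → p + j ≡ d → q + j ≡ u
rank-transfer {p} {q} {u} {d} {j} balance pj≡d = sym (+-cancelˡ-≡ p _ _ (begin
  p + u        ≡⟨ balance ⟩
  q + d        ≡⟨ cong (_+_ q) (sym pj≡d) ⟩
  q + (p + j)  ≡⟨ x∙yz≈y∙xz q p j ⟩
  p + (q + j)  ∎))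
  where open ≡-Reasoning

-- The down-step flipped by g is the (d₀ x + 1)-th one touching y = 0,
-- i.e. has rank d₀ x (j = 0); the up-step flipped by h is the u₁ y-th one touching y = 1, i.e.
-- has rank u₁ y − 1 (j = 1). For balanced x the two rank conditions are equivalent.
record Flip (j : ℕ) (x y : Path) : Set where
  constructor flipAt
  field
    before after : Path
    downSplit : x ≡ before ++ D ∷ after
    upSplit : y ≡ before ++ U ∷ after
    inBand : InBand (endHeight (+ 0) before)
    downRank : count (touchingDown (+ 0)) before + j ≡ d[ + 0 ] x
    upRank : count (touchingUp (+ 1)) before + j ≡ u[ + 1 ] y

flip-byDownRank : ∀ {j x} a b → x ≡ a ++ D ∷ b → endHeight (+ 0) x ≡ + 0 →
  InBand (endHeight (+ 0) a) → count (touchingDown (+ 0)) a + j ≡ d[ + 0 ] x → Flip j x (a ++ U ∷ b)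
flip-byDownRank a b refl end≡0 band rank =
  flipAt a b refl refl band rank (rank-transfer (touchRanks-flip a b band end≡0) rank)

flip-byUpRank : ∀ {j y} a b → y ≡ a ++ U ∷ b → endHeight (+ 0) y ≡ + 2 →
  InBand (endHeight (+ 0) a) → count (touchingUp (+ 1)) a + j ≡ u[ + 1 ] y → Flip j (a ++ D ∷ b) y
flip-byUpRank a b refl end≡2 band rank =
  flipAt a b refl refl band (rank-transfer (sym (touchRanks-flip a b band (endHeight-lower a b end≡2))) rank) rank

flip-endHeight : ∀ {j x y} → Flip j x y → endHeight (+ 0) x ≡ + 0 → endHeight (+ 0) y ≡ + 2
flip-endHeight (flipAt a b refl refl _ _ _) end≡0 = trans (endHeight-flip (+ 0) a b) (cong (_+ℤ + 2) end≡0)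

flip-length : ∀ {j x y} → Flip j x y → length y ≡ length x
flip-length (flipAt a b refl refl _ _ _) = length-flip a b

flip-ups : ∀ {j x y} → Flip j x y → ups y ≡ suc (ups x)
flip-ups (flipAt a b refl refl _ _ _) = ups-flip a b

flip-flaws : ∀ {j x y} → Flip j x y → flaws x ≡ count (downAtMost (+ 1)) y + j
flip-flaws {j} (flipAt a b refl refl band downRank _) = +-cancelʳ-≡ T _ _ (begin
  flaws (a ++ D ∷ b) + T        ≡⟨ flaws-flip a b band ⟩
  L + d[ + 0 ] (a ++ D ∷ b)     ≡⟨ cong (_+_ L) (sym downRank) ⟩
  L + (T + j)                   ≡⟨ x∙yz≈xz∙y L T j ⟩
  (L + j) + T                   ∎)
  where
    open ≡-Reasoning
    T = count (touchingDown (+ 0)) a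
    L = count (downAtMost (+ 1)) (a ++ U ∷ b)

hmap-suc : ∀ y m → u[ + 1 ] y ≡ suc m → hmap y ≡ replaceFrom (touchingUp (+ 1)) m D (+ 0) y
hmap-suc y m u₁≡ with u[ + 1 ] y | u₁≡
... | .(suc m) | refl = refl

flip-g : ∀ {x y} → Flip 0 x y → g x ≡ y
flip-g (flipAt a b refl refl band downRank _) =
  replaceFrom-occurrence (touchingDown (+ 0)) _ U (+ 0) a D b (trans (sym (+-identityʳ _)) downRank)
    (inBand-touchingDown _ band)

flip-hmap : ∀ {y z} → Flip 1 z y → hmap y ≡ z
flip-hmap (flipAt a b refl refl band _ upRank) =
  trans (hmap-suc (a ++ U ∷ b) _ (trans (sym upRank) (+-comm _ 1)))
        (replaceFrom-occurrence (touchingUp (+ 1)) _ D (+ 0) a U b refl (inBand-touchingUp _ band))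

flip-unique-up : ∀ {j x y y′} → Flip j x y → Flip j x y′ → y ≡ y′
flip-unique-up (flipAt a b refl refl band rank _) (flipAt a′ b′ x≡ refl band′ rank′ _)
  with occurrence-unique (touchingDown (+ 0)) (+ 0) a D b a′ D b′ x≡
         (inBand-touchingDown _ band) (inBand-touchingDown _ band′)
         (+-cancelʳ-≡ _ _ _ (trans rank (sym rank′)))
... | refl , refl = refl

flip-unique-down : ∀ {j x x′ y} → Flip j x y → Flip j x′ y → x ≡ x′
flip-unique-down (flipAt a b refl refl band _ rank) (flipAt a′ b′ refl y≡ band′ _ rank′)
  with occurrence-unique (touchingUp (+ 1)) (+ 0) a U b a′ U b′ y≡
         (inBand-touchingUp _ band) (inBand-touchingUp _ band′)
         (+-cancelʳ-≡ _ _ _ (trans rank (sym rank′)))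
... | refl , refl = refl

raise₀ : ∀ x → endHeight (+ 0) x ≡ + 0 → flaws x < downs x → ∃ (Flip 0 x)
raise₀ x end≡0 fl<dn
  with nthOccurrence (touchingDown (+ 0)) (d[ + 0 ] x) (+ 0) x (d[0]<touchingDowns x end≡0 fl<dn)
... | occurrence a s b x≡ rank marked with touchingDown-inBand (endHeight (+ 0) a) s marked
...   | refl , band = _ , flip-byDownRank a b x≡ end≡0 band (trans (+-identityʳ _) rank)

raise₁ : ∀ z → endHeight (+ 0) z ≡ + 0 → 0 < flaws z → ∃ (Flip 1 z)
raise₁ z end≡0 flawed with d[ + 0 ] z in d₀≡ | 0<flaws⇒0<d[0] z flawed | d[0]≤touchingDowns z
... | zero | () | _
... | suc n | _ | n<touchingDowns with nthOccurrence (touchingDown (+ 0)) n (+ 0) z n<touchingDowns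
...   | occurrence a s b z≡ rank marked with touchingDown-inBand (endHeight (+ 0) a) s marked
...     | refl , band =
  _ , flip-byDownRank a b z≡ end≡0 band (trans (cong (_+ 1) rank) (trans (+-comm n 1) (sym d₀≡)))

lower₀ : ∀ y → endHeight (+ 0) y ≡ + 2 → ∃ λ x → Flip 0 x y
lower₀ y end≡2 with nthOccurrence (touchingUp (+ 1)) (u[ + 1 ] y) (+ 0) y (u[1]<touchingUps y end≡2)
... | occurrence a s b y≡ rank marked with touchingUp-inBand (endHeight (+ 0) a) s marked
...   | refl , band = _ , flip-byUpRank a b y≡ end≡2 band (trans (+-identityʳ _) rank)

lower₁ : ∀ y → endHeight (+ 0) y ≡ + 2 → ∃ λ z → Flip 1 z y
lower₁ y end≡2 with u[ + 1 ] y in u₁≡ | u[1]≡1+d[2] y end≡2 | u[1]<touchingUps y end≡2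
... | zero | () | _
... | suc n | _ | n<touchingUps with nthOccurrence (touchingUp (+ 1)) n (+ 0) y (<-trans (n<1+n n) n<touchingUps)
...   | occurrence a s b y≡ rank marked with touchingUp-inBand (endHeight (+ 0) a) s marked
...     | refl , band = _ , flip-byUpRank a b y≡ end≡2 band
                        (trans (cong (_+ 1) rank) (trans (+-comm n 1) (sym u₁≡)))

-- f as a composite of two flips

_⇝_ : Path → Path → Set
x ⇝ z = ∃ λ y → Flip 0 x y × Flip 1 z y

⇝-f : ∀ {x z} → x ⇝ z → f x ≡ z
⇝-f (y , r₀ , r₁) = trans (cong hmap (flip-g r₀)) (flip-hmap r₁)

f-⇝ : ∀ {k e} x → e < k → InD k e x → x ⇝ f x
f-⇝ x e<k (len , up , fl) =
  let end≡0 = endHeight-balanced x len up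
      (y , r₀) = raise₀ x end≡0 (subst₂ _<_ (sym fl) (sym (downs-balanced x len up)) e<k)
      (z , r₁) = lower₁ y (flip-endHeight r₀ end≡0)
  in subst (x ⇝_) (sym (⇝-f (y , r₀ , r₁))) (y , r₀ , r₁)

⇝-preimage : ∀ {k e} z → InD k (suc e) z → ∃ (_⇝ z)
⇝-preimage z (len , up , fl) =
  let end≡0 = endHeight-balanced z len up
      (y , r₁) = raise₁ z end≡0 (subst (0 <_) (sym fl) (s≤s z≤n))
      (x , r₀) = lower₀ y (flip-endHeight r₁ end≡0)
  in x , y , r₀ , r₁

⇝-invariants : ∀ {x z} → x ⇝ z → length z ≡ length x × ups z ≡ ups x × flaws z ≡ suc (flaws x)
⇝-invariants (y , r₀ , r₁) =
    trans (sym (flip-length r₁)) (flip-length r₀)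
  , suc-injective (trans (sym (flip-ups r₁)) (flip-ups r₀))
  , trans (flip-flaws r₁) (trans (+-comm _ 1) (cong suc (trans (sym (+-identityʳ _)) (sym (flip-flaws r₀)))))

⇝-InD : ∀ {k e x z} → x ⇝ z → InD k e x → InD k (suc e) z
⇝-InD r (len , up , fl) =
  let (l , u , φ) = ⇝-invariants r in trans l len , trans u up , trans φ (cong suc fl)

⇝-InD⁻ : ∀ {k e x z} → x ⇝ z → InD k (suc e) z → InD k e x
⇝-InD⁻ r (len , up , fl) =
  let (l , u , φ) = ⇝-invariants r in trans (sym l) len , trans (sym u) up , suc-injective (trans (sym φ) fl)

⇝-injective : ∀ {x x′ z} → x ⇝ z → x′ ⇝ z → x ≡ x′
⇝-injective (y , r₀ , r₁) (y′ , r₀′ , r₁′) with flip-unique-up r₁ r₁′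
... | refl = flip-unique-down r₀ r₀′

⇝-diffCount : ∀ {x z} → x ⇝ z → diffCount x z ≡ 2
⇝-diffCount (_ , flipAt a b refl refl _ _ rank₀ , flipAt c w refl y≡ _ _ rank₁)
  with lowerRank⇒prefix (touchingUp (+ 1)) (+ 0) a U b c U w y≡
         (≤-reflexive (trans (+-comm 1 _) (trans rank₁ (trans (sym rank₀) (+-identityʳ _)))))
... | v , refl , refl = diffCount-swap c v b

theorem2 : ∀ (k e : ℕ) → 1 ≤ k → e < k →
    (∀ x → InD k e x → InD k (suc e) (f x))
    × (∀ x y → InD k e x → InD k e y → f x ≡ f y → x ≡ y)
    × (∀ y → InD k (suc e) y → ∃ λ x → InD k e x × f x ≡ y)
    × (∀ x → InD k e x → diffCount x (f x) ≡ 2)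
-- 1 ≤ k follows from e < k.
theorem2 k e _ e<k =
    (λ x ix → ⇝-InD (f-⇝ x e<k ix) ix)
  , (λ x x′ ix ix′ fx≡fx′ →
       ⇝-injective (f-⇝ x e<k ix) (subst (x′ ⇝_) (sym fx≡fx′) (f-⇝ x′ e<k ix′)))
  , (λ z iz → let (x , r) = ⇝-preimage z iz in x , ⇝-InD⁻ r iz , ⇝-f r)
  , (λ x ix → ⇝-diffCount (f-⇝ x e<k ix))
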